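{- Let $n,k$ be integers with $8\le 2k\le n-2$. Let $\eta=(\eta_1<\dots<\eta_l)\in\mathbb{D}_k$, let $Y_{2\eta^*}$ be the Young diagram whose main diagonal consists of exactly the $l+1$ cells $c_{1,1},\dots,c_{l+1,l+1}$ with $h_{1,1}=2n-4$, $h_{i,i}=2\eta_{l-(i-2)}$ ($2\le i\le l+1$) and $a(c_{i,i})=l(c_{i,i})+1$ ($1\le i\le l+1$), and let $\lambda$ be the partition whose parts are the hook lengths of the first-column cells of $Y_{2\eta^*}$. Then $\lambda$ is a partition of $T_{n,n-2k+1}=n(n+1)/2-(n-2k+1)$.
   Context: $\mathbb{D}_k$ is the set of partitions of $k$ into distinct parts with at least two parts. Young diagrams in English convention; $c_{i,j}$ is the cell in row $i$, column $j$; arm $a$ = cells to the right, leg $l$ = cells below, $h_{i,j}=a(c_{i,j})+l(c_{i,j})+1$. -}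

module Defs where

open import Data.Nat using (ℕ; zero; suc; _+_; _*_; _∸_; _≤_; _<_; _≥_; _≤?_)
open import Data.Nat.DivMod using (_/_)
open import Data.List using (List; []; _∷_; length; map; filter)
open import Data.Nat.ListAction using (sum)
open import Relation.Binary.PropositionalEquality using (_≡_)
open import Data.List.Relation.Unary.All using (All)
open import Data.List.Relation.Unary.Linked using (Linked)
open import Data.Product using (_×_)

-- 1-based access to the parts of a list; out of range gives 0.
-- at μ i = μ_i  (i ≥ 1)
at : List ℕ → ℕ → ℕ
at []       _             = 0
at (x ∷ xs) zero          = 0
at (x ∷ xs) (suc zero)    = x
at (x ∷ xs) (suc (suc i)) = at xs (suc i)

-- A partition / Young diagram: weakly decreasing list of positive row lengths.
IsPartition : List ℕ → Set
IsPartition μ = Linked _≥_ μ × All (λ x → 0 < x) μ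

InD : ℕ → List ℕ → Set
InD k η = Linked _<_ η × All (λ x → 0 < x) η × 2 ≤ length η × sum η ≡ k

-- cell c_{i,j} (row i, column j, 1-based, English convention)
InDiagram : List ℕ → ℕ → ℕ → Set
InDiagram μ i j = 1 ≤ i × 1 ≤ j × j ≤ at μ i

colLen : List ℕ → ℕ → ℕ
colLen μ j = length (filter (j ≤?_) μ)

arm : List ℕ → ℕ → ℕ → ℕ
arm μ i j = at μ i ∸ j

leg : List ℕ → ℕ → ℕ → ℕ
leg μ i j = colLen μ j ∸ i

hook : List ℕ → ℕ → ℕ → ℕ
hook μ i j = arm μ i j + leg μ i j + 1

oneTo : ℕ → List ℕ
oneTo zero    = []
oneTo (suc m) = go (suc m) 1
  where
  go : ℕ → ℕ → List ℕ
  go zero    _ = []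
  go (suc r) s = s ∷ go r (suc s)

firstColumnHooks : List ℕ → List ℕ
firstColumnHooks μ = map (λ i → hook μ i 1) (oneTo (length μ))

T : ℕ → ℕ → ℕ
T n m = (n * suc n) / 2 ∸ m

-- By the Frobenius identity the diagonal hooks of Y sum to |Y|; they are 2n-4 and 2η_l, …, 2η_1, so
-- |Y| = 2(n-2) + 2k. Since arm = leg + 1 at c₁₁, h₁₁ = 2(leg + 1) is twice the number of rows, so Y has n-2 rows,
-- and the first-column hooks Y_i + (n-2-i) add (n-2)(n-3)/2 to |Y|. They decrease weakly because Y does.
module Submission where

open import Defs
open import Data.Nat using (ℕ; _+_; _*_; _∸_; _≤_)
open import Data.List using (List; length)
open import Data.Nat.ListAction using (sum)
open import Data.Product using (_×_)
open import Function.Bundles using (_⇔_)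
open import Relation.Binary.PropositionalEquality using (_≡_)

open import Data.Nat using (zero; suc; _<_; _≥_; _≤?_; z≤n; s≤s; z<s; s<s)
open import Data.Nat.Properties
open import Data.Nat.DivMod using (_/_; m*n/n≡m)
open import Data.Nat.ListAction.Properties using (sum-++)
open import Data.Nat.Tactic.RingSolver using (solve-∀)
open import Algebra.Properties.CommutativeSemigroup +-commutativeSemigroup using () renaming (interchange to +-interchange)
open import Data.List using ([]; _∷_; [_]; _++_; map; filter; take; drop; applyUpTo)
open import Data.List.Properties
  using (map-applyUpTo; length-++; length-take; take-all; take++drop≡id; filter-++; filter-all; filter-accept; filter-reject)
open import Data.List.Relation.Unary.All as All using (All; []; _∷_)
open import Data.List.Relation.Unary.All.Properties as All using ()
open import Data.List.Relation.Unary.Linked as Linked using (Linked; []; [-]; _∷_)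
open import Data.List.Relation.Unary.Linked.Properties as Linked using (Linked⇒All)
open import Data.Product using (_,_; proj₁; proj₂)
open import Function.Base using (_∘_; flip)
open import Function.Bundles using (module Equivalence)
open import Relation.Binary.PropositionalEquality using (refl; sym; trans; cong; cong₂; subst; module ≡-Reasoning)
open import Relation.Nullary using (¬_; yes; no)

private
  variable
    d i j x : ℕ
    μ : List ℕ
    f g : ℕ → ℕ

∑< : ℕ → (ℕ → ℕ) → ℕ
∑< d f = sum (applyUpTo f d)

syntax ∑< d (λ i → e) = ∑[ i < d ] e

∑-cong : (∀ {i} → i < d → f i ≡ g i) → ∑< d f ≡ ∑< d g
∑-cong {zero}  f≡g = refl
∑-cong {suc d} f≡g = cong₂ _+_ (f≡g z<s) (∑-cong (λ i<d → f≡g (s<s i<d)))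

∑-distrib-+ : ∀ d → ∑[ i < d ] (f i + g i) ≡ ∑< d f + ∑< d g
∑-distrib-+ zero = refl
∑-distrib-+ {f} {g} (suc d) = trans (cong (f 0 + g 0 +_) (∑-distrib-+ d)) (+-interchange (f 0) (g 0) _ _)

*-distribˡ-∑ : ∀ c d → ∑[ i < d ] (c * f i) ≡ c * ∑< d f
*-distribˡ-∑ c zero = sym (*-zeroʳ c)
*-distribˡ-∑ {f} c (suc d) = trans (cong (c * f 0 +_) (*-distribˡ-∑ c d)) (sym (*-distribˡ-+ c (f 0) _))

∑-const : ∀ d c → ∑[ i < d ] c ≡ d * c
∑-const zero    c = refl
∑-const (suc d) c = cong (c +_) (∑-const d c)

∑-zero : ∀ d → ∑[ i < d ] 0 ≡ 0
∑-zero d = trans (∑-const d 0) (*-zeroʳ d)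

∑-snoc : ∀ d → ∑< (suc d) f ≡ ∑< d f + f d
∑-snoc {f} zero    = +-comm (f 0) 0
∑-snoc {f} (suc d) = trans (cong (f 0 +_) (∑-snoc d)) (sym (+-assoc (f 0) _ _))

∑-reverse : ∀ d → ∑[ i < d ] f (d ∸ suc i) ≡ ∑< d f
∑-reverse zero = refl
∑-reverse {f} (suc d) = begin
  f d + ∑[ i < d ] f (d ∸ suc i)  ≡⟨ cong (f d +_) (∑-reverse d) ⟩
  f d + ∑< d f                    ≡⟨ +-comm (f d) _ ⟩
  ∑< d f + f d                    ≡⟨ ∑-snoc d ⟨
  ∑< (suc d) f                    ∎
  where open ≡-Reasoning

triangle : ∀ d → 2 * ∑[ i < d ] i + d ≡ d * d
triangle zero = refl
triangle (suc d) = begin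
  2 * ∑[ i < suc d ] i + suc d  ≡⟨ cong (λ s → 2 * s + suc d) (∑-snoc d) ⟩
  2 * (s + d) + suc d           ≡⟨ regroup s d ⟩
  (2 * s + d) + (2 * d + 1)     ≡⟨ cong (_+ (2 * d + 1)) (triangle d) ⟩
  d * d + (2 * d + 1)           ≡⟨ square-suc d ⟩
  suc d * suc d                 ∎
  where
  open ≡-Reasoning
  s = ∑[ i < d ] i
  regroup : ∀ s d → 2 * (s + d) + suc d ≡ (2 * s + d) + (2 * d + 1)
  regroup = solve-∀
  square-suc : ∀ d → d * d + (2 * d + 1) ≡ suc d * suc d
  square-suc = solve-∀

∑-odd : ∀ d → ∑[ i < d ] (2 * i + 1) ≡ d * d
∑-odd d = begin
  ∑[ i < d ] (2 * i + 1)         ≡⟨ ∑-distrib-+ d ⟩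
  ∑[ i < d ] (2 * i) + ∑[ i < d ] 1
                                 ≡⟨ cong₂ _+_ (*-distribˡ-∑ 2 d) (trans (∑-const d 1) (*-identityʳ d)) ⟩
  2 * ∑[ i < d ] i + d           ≡⟨ triangle d ⟩
  d * d                          ∎
  where open ≡-Reasoning

∑-at : ∀ d μ → ∑[ i < d ] at μ (suc i) ≡ sum (take d μ)
∑-at zero    μ       = refl
∑-at (suc d) []      = ∑-zero d
∑-at (suc d) (x ∷ μ) = cong (x +_) (∑-at d μ)

at-antitone : Linked _≥_ μ → i ≤ j → at μ (suc j) ≤ at μ (suc i)
at-antitone {[]}        _           _         = z≤n
at-antitone {_ ∷ _}     _           (z≤n {zero})  = ≤-refl
at-antitone {_ ∷ []}    _           (z≤n {suc j}) = z≤n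
at-antitone {_ ∷ _ ∷ _} (x≥y ∷ μ↓) (z≤n {suc j}) = ≤-trans (at-antitone {j = j} μ↓ z≤n) x≥y
at-antitone {_ ∷ _}     μ↓          (s≤s i≤j) = at-antitone (Linked.tail μ↓) i≤j

≤at⇒≤length : ∀ d μ → d ≤ at μ d → d ≤ length μ
≤at⇒≤length zero          μ       _ = z≤n
≤at⇒≤length (suc zero)    (x ∷ μ) _ = s≤s z≤n
≤at⇒≤length (suc (suc d)) (x ∷ μ) p = s≤s (≤at⇒≤length (suc d) μ (<⇒≤ p))

at-All : ∀ {P : ℕ → Set} → All P μ → i < length μ → P (at μ (suc i))
at-All {i = zero}  (px ∷ _)   _         = px
at-All {i = suc i} (_  ∷ pμ) (s<s i<n) = at-All pμ i<n

take-≥-at : ∀ d → Linked _≥_ μ → All (at μ d ≤_) (take d μ)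
take-≥-at          zero          _  = []
take-≥-at {[]}     (suc d)       _  = []
take-≥-at {_ ∷ _}  (suc zero)    _  = ≤-refl ∷ []
take-≥-at {_ ∷ _}  (suc (suc d)) μ↓ = at-antitone {j = suc d} μ↓ z≤n ∷ take-≥-at (suc d) (Linked.tail μ↓)

drop-≤-at : ∀ d → Linked _≥_ μ → All (_≤ at μ (suc d)) (drop d μ)
drop-≤-at {[]}    zero    _  = []
drop-≤-at {[]}    (suc d) _  = []
drop-≤-at {x ∷ μ} zero    μ↓ = Linked⇒All (flip ≤-trans) ≤-refl μ↓
drop-≤-at {x ∷ μ} (suc d) μ↓ = drop-≤-at d (Linked.tail μ↓)

colLen-++ : ∀ A B j → colLen (A ++ B) j ≡ colLen A j + colLen B j
colLen-++ A B j = trans (cong length (filter-++ (j ≤?_) A B)) (length-++ (filter (j ≤?_) A))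

colLen-all : All (j ≤_) μ → colLen μ j ≡ length μ
colLen-all {j} μ≥j = cong length (filter-all (j ≤?_) μ≥j)

colLen-[]-≤ : j ≤ x → colLen [ x ] j ≡ 1
colLen-[]-≤ {j} j≤x = cong length (filter-accept (j ≤?_) j≤x)

colLen-[]-≰ : ¬ j ≤ x → colLen [ x ] j ≡ 0
colLen-[]-≰ {j} j≰x = cong length (filter-reject (j ≤?_) j≰x)

colLen-[]-suc : ∀ x j → colLen [ suc x ] (suc j) ≡ colLen [ x ] j
colLen-[]-suc x j with j ≤? x
... | yes j≤x = trans (colLen-[]-≤ (s≤s j≤x)) (sym (colLen-[]-≤ j≤x))
... | no  j≰x = trans (colLen-[]-≰ (j≰x ∘ ≤-pred)) (sym (colLen-[]-≰ j≰x))

∑-colLen-[] : x ≤ d → ∑[ j < d ] colLen [ x ] (suc j) ≡ x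
∑-colLen-[] {zero}  {d}     _         = trans (∑-cong {d} (λ {j} _ → colLen-[]-≰ {j = suc j} {x = 0} λ ())) (∑-zero d)
∑-colLen-[] {suc x} {suc d} (s≤s x≤d) =
  cong₂ _+_ (colLen-[]-≤ {x = suc x} (s≤s z≤n)) (trans (∑-cong {d} (λ {j} _ → colLen-[]-suc x (suc j))) (∑-colLen-[] x≤d))

∑-colLen : All (_≤ d) μ → ∑[ j < d ] colLen μ (suc j) ≡ sum μ
∑-colLen {d} []                          = ∑-zero d
∑-colLen {d} {x ∷ μ} (x≤d ∷ μ≤d) = begin
  ∑[ j < d ] colLen (x ∷ μ) (suc j)                     ≡⟨ ∑-cong {d} (λ {j} _ → colLen-++ [ x ] μ (suc j)) ⟩
  ∑[ j < d ] (colLen [ x ] (suc j) + colLen μ (suc j))  ≡⟨ ∑-distrib-+ d ⟩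
  ∑[ j < d ] colLen [ x ] (suc j) + ∑[ j < d ] colLen μ (suc j)
                                                         ≡⟨ cong₂ _+_ (∑-colLen-[] x≤d) (∑-colLen μ≤d) ⟩
  x + sum μ                                             ∎
  where open ≡-Reasoning

durfee-diagonal : Linked _≥_ μ → d ≤ at μ d → i < d → suc i ≤ at μ (suc i)
durfee-diagonal μ↓ d≤μd (s≤s i≤d) = ≤-trans (s≤s i≤d) (≤-trans d≤μd (at-antitone μ↓ i≤d))

hook-diagonal : suc i ≤ at μ (suc i) → suc i ≤ colLen μ (suc i) →
                hook μ (suc i) (suc i) + (2 * i + 1) ≡ at μ (suc i) + colLen μ (suc i)
hook-diagonal {i} {μ} i<a i<c = begin
  (a ∸ suc i) + (c ∸ suc i) + 1 + (2 * i + 1)  ≡⟨ regroup (a ∸ suc i) (c ∸ suc i) i ⟩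
  (a ∸ suc i + suc i) + (c ∸ suc i + suc i)    ≡⟨ cong₂ _+_ (m∸n+n≡m i<a) (m∸n+n≡m i<c) ⟩
  a + c                                        ∎
  where
  open ≡-Reasoning
  a = at μ (suc i)
  c = colLen μ (suc i)
  regroup : ∀ x y i → x + y + 1 + (2 * i + 1) ≡ (x + suc i) + (y + suc i)
  regroup = solve-∀

-- h(i,i) + 2i - 1 = μ_i + μ'_i. Summed over i ≤ d, the rows give the first d parts, the columns give d·d plus
-- the parts below row d (all at most d), and the odd numbers give d·d.
∑-hook-diagonal≡sum : ∀ d → Linked _≥_ μ → d ≤ at μ d → at μ (suc d) ≤ d →
            ∑[ i < d ] hook μ (suc i) (suc i) ≡ sum μ
∑-hook-diagonal≡sum {μ} d μ↓ d≤μd μd+1≤d = +-cancelʳ-≡ (d * d) _ _ (begin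
  ∑[ i < d ] H i + d * d                         ≡⟨ cong (∑[ i < d ] H i +_) (∑-odd d) ⟨
  ∑[ i < d ] H i + ∑[ i < d ] (2 * i + 1)        ≡⟨ ∑-distrib-+ d ⟨
  ∑[ i < d ] (H i + (2 * i + 1))                 ≡⟨ ∑-cong diagonal ⟩
  ∑[ i < d ] (at μ (suc i) + colLen B (suc i) + d)
                                                 ≡⟨ trans (∑-distrib-+ d) (cong₂ _+_ (∑-distrib-+ d) (∑-const d d)) ⟩
  ∑[ i < d ] at μ (suc i) + ∑[ i < d ] colLen B (suc i) + d * d
                                                 ≡⟨ cong (λ s → s + d * d) (cong₂ _+_ (∑-at d μ) (∑-colLen B≤d)) ⟩
  sum A + sum B + d * d                          ≡⟨ cong (_+ d * d) (trans (sym (sum-++ A B)) (cong sum (take++drop≡id d μ))) ⟩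
  sum μ + d * d                                  ∎)
  where
  open ≡-Reasoning
  H : ℕ → ℕ
  H i = hook μ (suc i) (suc i)
  A = take d μ
  B = drop d μ
  A≥d : All (d ≤_) A
  A≥d = All.map (≤-trans d≤μd) (take-≥-at d μ↓)
  B≤d : All (_≤ d) B
  B≤d = All.map (λ b≤ → ≤-trans b≤ μd+1≤d) (drop-≤-at d μ↓)
  colLen-split : i < d → colLen μ (suc i) ≡ d + colLen B (suc i)
  colLen-split {i} i<d = begin
    colLen μ (suc i)                     ≡⟨ cong (λ ν → colLen ν (suc i)) (take++drop≡id d μ) ⟨
    colLen (A ++ B) (suc i)              ≡⟨ colLen-++ A B (suc i) ⟩
    colLen A (suc i) + colLen B (suc i)  ≡⟨ cong (_+ colLen B (suc i)) (colLen-all (All.map (≤-trans i<d) A≥d)) ⟩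
    length A + colLen B (suc i)          ≡⟨ cong (_+ colLen B (suc i)) (trans (length-take d μ) (m≤n⇒m⊓n≡m (≤at⇒≤length d μ d≤μd))) ⟩
    d + colLen B (suc i)                 ∎
  diagonal : i < d → H i + (2 * i + 1) ≡ at μ (suc i) + colLen B (suc i) + d
  diagonal {i} i<d = begin
    H i + (2 * i + 1)            ≡⟨ hook-diagonal {μ = μ} (durfee-diagonal μ↓ d≤μd i<d) i<colLen ⟩
    a + colLen μ (suc i)         ≡⟨ cong (a +_) (trans (colLen-split i<d) (+-comm d _)) ⟩
    a + (colLen B (suc i) + d)   ≡⟨ +-assoc a _ d ⟨
    a + colLen B (suc i) + d     ∎
    where
    a = at μ (suc i)
    i<colLen : suc i ≤ colLen μ (suc i)
    i<colLen = subst (suc i ≤_) (sym (colLen-split i<d)) (≤-trans i<d (m≤m+n d _))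

applyUpTo-cong : (∀ i → f i ≡ g i) → ∀ d → applyUpTo f d ≡ applyUpTo g d
applyUpTo-cong f≗g zero    = refl
applyUpTo-cong f≗g (suc d) = cong₂ _∷_ (f≗g 0) (applyUpTo-cong (f≗g ∘ suc) d)

-- `oneTo` counts up with a helper local to Defs; abstracting its arguments lets unification name it `countUp`.
mutual
  countUp : ℕ → ℕ → ℕ → List ℕ
  countUp = _

  oneTo-unfold : ∀ m → oneTo (suc (suc m)) ≡ 1 ∷ 2 ∷ countUp (suc m) m 3
  oneTo-unfold m with suc m | 3
  ... | _ | _ = refl

countUp≡applyUpTo : ∀ p r s → countUp p r s ≡ applyUpTo (s +_) r
countUp≡applyUpTo p zero    s = refl
countUp≡applyUpTo p (suc r) s = begin
  s ∷ countUp p r (suc s)     ≡⟨ cong (s ∷_) (countUp≡applyUpTo p r (suc s)) ⟩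
  s ∷ applyUpTo (suc s +_) r  ≡⟨ cong₂ _∷_ (+-identityʳ s) (applyUpTo-cong (+-suc s) r) ⟨
  applyUpTo (s +_) (suc r)    ∎
  where open ≡-Reasoning

oneTo≡applyUpTo : ∀ r → oneTo r ≡ applyUpTo suc r
oneTo≡applyUpTo zero          = refl
oneTo≡applyUpTo (suc zero)    = refl
oneTo≡applyUpTo (suc (suc m)) = trans (oneTo-unfold m) (cong (λ ns → 1 ∷ 2 ∷ ns) (countUp≡applyUpTo (suc m) m 3))

firstColumnHooks≡applyUpTo : ∀ μ → firstColumnHooks μ ≡ applyUpTo (λ i → hook μ (suc i) 1) (length μ)
firstColumnHooks≡applyUpTo μ =
  trans (cong (map (λ i → hook μ i 1)) (oneTo≡applyUpTo (length μ))) (map-applyUpTo suc (λ i → hook μ i 1) (length μ))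

sum-firstColumnHooks : All (0 <_) μ → sum (firstColumnHooks μ) ≡ sum μ + ∑[ i < length μ ] i
sum-firstColumnHooks {μ} μ>0 = begin
  sum (firstColumnHooks μ)                           ≡⟨ cong sum (firstColumnHooks≡applyUpTo μ) ⟩
  ∑[ i < r ] hook μ (suc i) 1                        ≡⟨ ∑-cong first-column ⟩
  ∑[ i < r ] (at μ (suc i) + (r ∸ suc i))            ≡⟨ ∑-distrib-+ r ⟩
  ∑[ i < r ] at μ (suc i) + ∑[ i < r ] (r ∸ suc i)   ≡⟨ cong₂ _+_ (trans (∑-at r μ) (cong sum (take-all r μ ≤-refl))) (∑-reverse r) ⟩
  sum μ + ∑[ i < r ] i                               ∎
  where
  open ≡-Reasoning
  r = length μ
  first-column : i < r → hook μ (suc i) 1 ≡ at μ (suc i) + (r ∸ suc i)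
  first-column {i} i<r = begin
    (a ∸ 1) + (colLen μ 1 ∸ suc i) + 1  ≡⟨ cong (λ c → (a ∸ 1) + (c ∸ suc i) + 1) (colLen-all μ>0) ⟩
    (a ∸ 1) + (r ∸ suc i) + 1           ≡⟨ +-assoc (a ∸ 1) _ 1 ⟩
    (a ∸ 1) + ((r ∸ suc i) + 1)         ≡⟨ cong ((a ∸ 1) +_) (+-comm _ 1) ⟩
    (a ∸ 1) + (1 + (r ∸ suc i))         ≡⟨ +-assoc (a ∸ 1) 1 _ ⟨
    (a ∸ 1) + 1 + (r ∸ suc i)           ≡⟨ cong (_+ (r ∸ suc i)) (m∸n+n≡m (at-All μ>0 i<r)) ⟩
    a + (r ∸ suc i)                     ∎
    where
    a = at μ (suc i)

firstColumnHooks-isPartition : Linked _≥_ μ → IsPartition (firstColumnHooks μ)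
firstColumnHooks-isPartition {μ} μ↓ = subst IsPartition (sym (firstColumnHooks≡applyUpTo μ))
  (Linked.applyUpTo⁺₂ h (length μ) h↓ , All.applyUpTo⁺₂ h (length μ) (λ _ → m≤n+m 1 _))
  where
  h : ℕ → ℕ
  h i = hook μ (suc i) 1
  h↓ : ∀ i → h (suc i) ≤ h i
  h↓ i = +-monoˡ-≤ 1 (+-mono-≤ (∸-monoˡ-≤ 1 (at-antitone μ↓ (n≤1+n i))) (∸-monoʳ-≤ (colLen μ 1) (n≤1+n (suc i))))

hook₁₁≡2*length : All (0 <_) μ → arm μ 1 1 ≡ leg μ 1 1 + 1 → hook μ 1 1 ≡ 2 * length μ
hook₁₁≡2*length {[]}    _   ()
hook₁₁≡2*length {x ∷ μ} μ>0 arm≡leg+1 = begin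
  arm (x ∷ μ) 1 1 + l + 1  ≡⟨ cong (λ a → a + l + 1) arm≡leg+1 ⟩
  l + 1 + l + 1            ≡⟨ cong (λ l → l + 1 + l + 1) (cong (_∸ 1) (colLen-all μ>0)) ⟩
  length μ + 1 + length μ + 1  ≡⟨ twice-suc (length μ) ⟩
  2 * suc (length μ)       ∎
  where
  open ≡-Reasoning
  l = leg (x ∷ μ) 1 1
  twice-suc : ∀ n → n + 1 + n + 1 ≡ 2 * suc n
  twice-suc = solve-∀

diagonal⇔⇒durfee : ∀ d → (∀ i → InDiagram μ i i ⇔ (1 ≤ i × i ≤ d)) → d ≤ at μ d × at μ (suc d) ≤ d
diagonal⇔⇒durfee {μ} d diagonal =
  corner d ≤-refl , ≮⇒≥ (λ d<μd+1 → 1+n≰n (proj₂ (Equivalence.to (diagonal (suc d)) (s≤s z≤n , s≤s z≤n , d<μd+1))))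
  where
  corner : ∀ e → e ≤ d → e ≤ at μ e
  corner zero    _   = z≤n
  corner (suc e) e<d = proj₂ (proj₂ (Equivalence.from (diagonal (suc e)) (s≤s z≤n , e<d)))

∑-at-reverse : ∀ η → ∑[ i < length η ] at η (length η ∸ i) ≡ sum η
∑-at-reverse η = begin
  ∑[ i < L ] at η (L ∸ i)            ≡⟨ ∑-cong {L} (λ i<L → cong (at η) (+-∸-assoc 1 i<L)) ⟩
  ∑[ i < L ] at η (suc (L ∸ suc i))  ≡⟨ ∑-reverse L ⟩
  ∑[ i < L ] at η (suc i)            ≡⟨ ∑-at L η ⟩
  sum (take L η)                     ≡⟨ cong sum (take-all L η ≤-refl) ⟩
  sum η                              ∎
  where
  open ≡-Reasoning
  L = length η

T-split : ∀ n m → m ≤ n ∸ 2 → 2 * (n ∸ 2) + m + ∑[ i < n ∸ 2 ] i ≡ T n (n + 1 ∸ m)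
T-split 0 .0 z≤n = refl
T-split 1 .0 z≤n = refl
T-split n@(suc (suc r)) m m≤r = begin
  X              ≡⟨ m+n∸n≡m X y ⟨
  X + y ∸ y      ≡⟨ cong (_∸ y) (m*n/n≡m (X + y) 2) ⟨
  (X + y) * 2 / 2 ∸ y  ≡⟨ cong (λ p → p / 2 ∸ y) double ⟩
  n * suc n / 2 ∸ y    ∎
  where
  open ≡-Reasoning
  y = n + 1 ∸ m
  q = ∑[ i < r ] i
  X = 2 * r + m + q
  regroup₁ : ∀ r m q y → 2 * r + m + q + y ≡ 2 * r + q + (y + m)
  regroup₁ = solve-∀
  regroup₂ : ∀ r q → (2 * r + q + (suc (suc r) + 1)) * 2 ≡ (2 * q + r) + (5 * r + 6)
  regroup₂ = solve-∀
  regroup₃ : ∀ r → r * r + (5 * r + 6) ≡ suc (suc r) * suc (suc (suc r))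
  regroup₃ = solve-∀
  double : (X + y) * 2 ≡ n * suc n
  double = begin
    (X + y) * 2                    ≡⟨ cong (_* 2) (regroup₁ r m q y) ⟩
    (2 * r + q + (y + m)) * 2      ≡⟨ cong (λ t → (2 * r + q + t) * 2) (m∸n+n≡m (m≤n⇒m≤n+o 1 (≤-trans m≤r (m≤n+m r 2)))) ⟩
    (2 * r + q + (n + 1)) * 2      ≡⟨ regroup₂ r q ⟩
    (2 * q + r) + (5 * r + 6)      ≡⟨ cong (_+ (5 * r + 6)) (triangle r) ⟩
    r * r + (5 * r + 6)            ≡⟨ regroup₃ r ⟩
    n * suc n                      ∎

proposition5p2 : (n k : ℕ) → 8 ≤ 2 * k → 2 * k ≤ n ∸ 2 →
    (η : List ℕ) → InD k η →
    (Y : List ℕ) → IsPartition Y →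
    ((i : ℕ) → InDiagram Y i i ⇔ (1 ≤ i × i ≤ length η + 1)) →
    hook Y 1 1 ≡ 2 * n ∸ 4 →
    ((i : ℕ) → 2 ≤ i → i ≤ length η + 1 → hook Y i i ≡ 2 * at η (length η ∸ (i ∸ 2))) →
    ((i : ℕ) → 1 ≤ i → i ≤ length η + 1 → arm Y i i ≡ leg Y i i + 1) →
    IsPartition (firstColumnHooks Y) × sum (firstColumnHooks Y) ≡ T n (n + 1 ∸ 2 * k)
proposition5p2 n k _ 2k≤n-2 η (_ , _ , _ , Ση≡k) Y (Y↓ , Y>0) diagonal hook₁₁ inner-hook arm≡leg+1 =
  firstColumnHooks-isPartition Y↓ , (begin
    sum (firstColumnHooks Y)                  ≡⟨ sum-firstColumnHooks Y>0 ⟩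
    sum Y + ∑[ i < length Y ] i               ≡⟨ cong₂ (λ s r → s + ∑[ i < r ] i) sum-Y length-Y ⟩
    2 * (n ∸ 2) + 2 * k + ∑[ i < n ∸ 2 ] i    ≡⟨ T-split n (2 * k) 2k≤n-2 ⟩
    T n (n + 1 ∸ 2 * k)                       ∎)
  where
  open ≡-Reasoning
  L = length η
  hook₁₁≡ : hook Y 1 1 ≡ 2 * (n ∸ 2)
  hook₁₁≡ = trans hook₁₁ (sym (*-distribˡ-∸ 2 n 2))
  length-Y : length Y ≡ n ∸ 2
  length-Y = *-cancelˡ-≡ _ _ 2 (trans (sym (hook₁₁≡2*length Y>0 (arm≡leg+1 1 ≤-refl (m≤n+m 1 L)))) hook₁₁≡)
  inner-hooks : ∑[ i < L ] hook Y (2 + i) (2 + i) ≡ 2 * k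
  inner-hooks = begin
    ∑[ i < L ] hook Y (2 + i) (2 + i)   ≡⟨ ∑-cong {L} (λ i<L → inner-hook _ (s≤s (s≤s z≤n)) (≤-trans (s≤s i<L) (≤-reflexive (+-comm 1 L)))) ⟩
    ∑[ i < L ] (2 * at η (L ∸ i))       ≡⟨ *-distribˡ-∑ 2 L ⟩
    2 * ∑[ i < L ] at η (L ∸ i)         ≡⟨ cong (2 *_) (trans (∑-at-reverse η) Ση≡k) ⟩
    2 * k                               ∎
  durfee : suc L ≤ at Y (suc L) × at Y (suc (suc L)) ≤ suc L
  durfee = diagonal⇔⇒durfee {Y} (suc L) (subst (λ d → ∀ i → InDiagram Y i i ⇔ (1 ≤ i × i ≤ d)) (+-comm L 1) diagonal)
  sum-Y : sum Y ≡ 2 * (n ∸ 2) + 2 * k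
  sum-Y = trans (sym (∑-hook-diagonal≡sum (suc L) Y↓ (proj₁ durfee) (proj₂ durfee))) (cong₂ _+_ hook₁₁≡ inner-hooks)
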